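{- Let $Q$ be the quiver on vertices $\{1,2,3,4,5\}$ with arrows $1\to2$, $1\to5$, $3\to1$, $4\to1$, $4\to5$, $5\to2$, $5\to3$, two arrows $2\to3$ and two arrows $3\to4$, and consider the initial seed $(Q,(x_1,x_2,x_3,x_4,x_5))$ with $x_1,\dots,x_5$ indeterminates. For a $\rho$-mutation sequence $\rho$ (operations defined in the context), write $\rho\{x_1,\dots,x_5\}$ for the ordered cluster obtained by applying $\rho$ to the initial seed. Then $$\rho_4\{x_1,\ldots,x_5\}=\rho_1^2\rho_3\{x_1,\ldots,x_5\},\quad \rho_5\{x_1,\ldots,x_5\}=\rho_2^2\rho_3\{x_1,\ldots,x_5\},$$ $$\rho_6\{x_1,\ldots,x_5\}=\rho_1^2\{x_1,\ldots,x_5\},\quad \rho_7\{x_1,\ldots,x_5\}=\rho_2^2\{x_1,\ldots,x_5\},$$ $$\rho_1\rho_2\{x_1,\ldots,x_5\}=\rho_2\rho_1\{x_1,\ldots,x_5\}=\rho_3^2\{x_1,\ldots,x_5\}=\{x_1,x_2,x_3,x_4,x_5\},$$ $$\rho_1^2\rho_3\{x_1,\ldots,x_5\}=\rho_3\rho_1^2\{x_1,\ldots,x_5\},\quad \rho_2^2\rho_3\{x_1,\ldots,x_5\}=\rho_3\rho_2^2\{x_1,\ldots,x_5\},$$ $$\rho_1\rho_3\rho_2\{x_1,\ldots,x_5\}=\rho_2\rho_3\rho_1\{x_1,\ldots,x_5\},$$ where all clusters are ordered 5-tuples of rational functions in $x_1,\dots,x_5$.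
   Context: A seed is a pair (quiver on vertex set $\{1,\dots,5\}$ without loops or 2-cycles, ordered cluster $(y_1,\dots,y_5)$ of rational functions), $y_i$ sitting at vertex $i$. Mutation $\mu_i$: for every 2-path $j\to i\to k$ add an arrow $j\to k$; reverse all arrows incident to $i$; delete 2-cycles created; and replace $y_i$ by $y_i'=\big(\prod_{i\to j}y_j^{a_{i\to j}}+\prod_{j\to i}y_j^{a_{j\to i}}\big)/y_i$ (using the quiver before mutation, $a_{i\to j}$ = number of arrows $i\to j$); other variables unchanged. For a permutation $\sigma$ of $\{1,\dots,5\}$ written in cycle notation, applying $\sigma$ relabels vertex $i$ as $\sigma(i)$, so the variable at vertex $i$ moves to vertex $\sigma(i)$ (e.g. $(54321)$ sends $5\mapsto4,4\mapsto3,3\mapsto2,2\mapsto1,1\mapsto5$). Operations are composed left to right (the leftmost is performed first): $\rho_1=\mu_1\circ(54321)$, $\rho_2=\mu_5\circ(12345)$, $\rho_3=\mu_2\circ\mu_4\circ(24)$, $\rho_4=\mu_2\circ\mu_1\circ\mu_4\circ(531)$, $\rho_5=\mu_4\circ\mu_5\circ\mu_2\circ(351)$, $\rho_6=\mu_2\circ\mu_1\circ\mu_2\circ(531)(24)$, $\rho_7=\mu_4\circ\mu_5\circ\mu_4\circ(135)(24)$. A product such as $\rho_a\rho_b$ means apply $\rho_a$ first, then $\rho_b$; $\rho^2=\rho\rho$. -}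

module Defs where

open import Data.Nat using (ℕ; zero; suc; _∸_) renaming (_+_ to _+ℕ_; _*_ to _*ℕ_)
import Data.Nat as ℕ
open import Data.Integer using (ℤ; +_) renaming (_+_ to _+ℤ_; _*_ to _*ℤ_)
open import Data.Fin using (Fin; zero; suc)
import Data.Fin as Fin
open import Data.Vec using (Vec; zipWith; replicate; tabulate)
open import Data.Vec.Properties using (≡-dec)
open import Data.List using (List; []; _∷_; _++_; concatMap; map; reverse)
open import Data.Product using (_×_; _,_; proj₁; proj₂)
open import Data.Bool using (if_then_else_)
open import Relation.Nullary.Decidable using (⌊_⌋)
open import Relation.Binary.PropositionalEquality using (_≡_)

-- A monomial is its exponent vector; a polynomial is a finite formal sum
-- of terms; two polynomials are equal iff they have the same coefficient
-- at every monomial.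

Mono : Set
Mono = Vec ℕ 5

record Term : Set where
  constructor _·_
  field
    coeff : ℤ
    mono  : Mono

Poly : Set
Poly = List Term

coeffOf : Poly → Mono → ℤ
coeffOf [] m = + 0
coeffOf ((c · e) ∷ p) m =
  (if ⌊ ≡-dec ℕ._≟_ e m ⌋ then c else + 0) +ℤ coeffOf p m

infix 4 _≈ₚ_
_≈ₚ_ : Poly → Poly → Set
p ≈ₚ q = ∀ (m : Mono) → coeffOf p m ≡ coeffOf q m

_+ₚ_ : Poly → Poly → Poly
p +ₚ q = p ++ q

_*ₜ_ : Term → Term → Term
(c · e) *ₜ (d · f) = (c *ℤ d) · zipWith _+ℕ_ e f

_*ₚ_ : Poly → Poly → Poly
p *ₚ q = concatMap (λ t → map (t *ₜ_) q) p

oneₚ : Poly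
oneₚ = ((+ 1) · replicate 5 0) ∷ []

varₚ : Fin 5 → Poly
varₚ i = ((+ 1) · tabulate (λ j → if ⌊ i Fin.≟ j ⌋ then 1 else 0)) ∷ []

record Frac : Set where
  constructor _/_
  field
    num : Poly
    den : Poly
open Frac public

infix 4 _≈f_
_≈f_ : Frac → Frac → Set
a ≈f b = num a *ₚ den b ≈ₚ num b *ₚ den a

_+f_ : Frac → Frac → Frac
(a / b) +f (c / d) = ((a *ₚ d) +ₚ (c *ₚ b)) / (b *ₚ d)

_*f_ : Frac → Frac → Frac
(a / b) *f (c / d) = (a *ₚ c) / (b *ₚ d)

invf : Frac → Frac
invf (a / b) = b / a

onef : Frac
onef = oneₚ / oneₚ

varf : Fin 5 → Frac
varf i = varₚ i / oneₚ

_^f_ : Frac → ℕ → Frac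
f ^f zero = onef
f ^f suc n = f *f (f ^f n)

-- Quivers on {1,…,5} (vertex k is Fin index k-1): Q i j = number of arrows i → j.

Quiver : Set
Quiver = Fin 5 → Fin 5 → ℕ

Cluster : Set
Cluster = Fin 5 → Frac

Seed : Set
Seed = Quiver × Cluster

v1 v2 v3 v4 v5 : Fin 5
v1 = zero
v2 = suc zero
v3 = suc (suc zero)
v4 = suc (suc (suc zero))
v5 = suc (suc (suc (suc zero)))

prod5 : (Fin 5 → Frac) → Frac
prod5 f = f v1 *f (f v2 *f (f v3 *f (f v4 *f f v5)))

-- Quiver mutation at i: add j → k for every path j → i → k, reverse the
-- arrows at i, cancel 2-cycles.
mutQ : Fin 5 → Quiver → Quiver
mutQ i Q j k =
  if ⌊ j Fin.≟ i ⌋ then Q k j else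
  if ⌊ k Fin.≟ i ⌋ then Q k j else
  (c j k ∸ c k j)
  where
    c : Fin 5 → Fin 5 → ℕ
    c a b = Q a b +ℕ (Q a i *ℕ Q i b)

-- Cluster mutation at i (using the quiver before mutation).
mutY : Fin 5 → Quiver → Cluster → Cluster
mutY i Q y k =
  if ⌊ k Fin.≟ i ⌋
  then (prod5 (λ j → y j ^f Q i j) +f prod5 (λ j → y j ^f Q j i)) *f invf (y i)
  else y k

μ : Fin 5 → Seed → Seed
μ i (Q , y) = mutQ i Q , mutY i Q y

-- The cyclic permutation given by a list in cycle notation:
-- each element goes to the next one, the last goes to the first.
cyc : List (Fin 5) → Fin 5 → Fin 5
cyc [] x = x
cyc (a ∷ as) x = go (a ∷ as)
  where
    go : List (Fin 5) → Fin 5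
    go [] = x
    go (b ∷ []) = if ⌊ b Fin.≟ x ⌋ then a else x
    go (b ∷ c ∷ bs) = if ⌊ b Fin.≟ x ⌋ then c else go (c ∷ bs)

-- Relabel vertex i as σ(i) (σ the cycle); given σ⁻¹, new data at vertex a
-- is the old data at σ⁻¹(a).
relabelBy : (Fin 5 → Fin 5) → Seed → Seed
relabelBy σinv (Q , y) = (λ a b → Q (σinv a) (σinv b)) , (λ a → y (σinv a))

perm : List (Fin 5) → Seed → Seed
perm c = relabelBy (cyc (reverse c))

-- Left-to-right composition: (f ⨾ g) performs f first.
infixl 5 _⨾_
_⨾_ : (Seed → Seed) → (Seed → Seed) → Seed → Seed
(f ⨾ g) s = g (f s)

ρ1 ρ2 ρ3 ρ4 ρ5 ρ6 ρ7 : Seed → Seed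
ρ1 = μ v1 ⨾ perm (v5 ∷ v4 ∷ v3 ∷ v2 ∷ v1 ∷ [])
ρ2 = μ v5 ⨾ perm (v1 ∷ v2 ∷ v3 ∷ v4 ∷ v5 ∷ [])
ρ3 = μ v2 ⨾ μ v4 ⨾ perm (v2 ∷ v4 ∷ [])
ρ4 = μ v2 ⨾ μ v1 ⨾ μ v4 ⨾ perm (v5 ∷ v3 ∷ v1 ∷ [])
ρ5 = μ v4 ⨾ μ v5 ⨾ μ v2 ⨾ perm (v3 ∷ v5 ∷ v1 ∷ [])
ρ6 = μ v2 ⨾ μ v1 ⨾ μ v2 ⨾ perm (v5 ∷ v3 ∷ v1 ∷ []) ⨾ perm (v2 ∷ v4 ∷ [])
ρ7 = μ v4 ⨾ μ v5 ⨾ μ v4 ⨾ perm (v1 ∷ v3 ∷ v5 ∷ []) ⨾ perm (v2 ∷ v4 ∷ [])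

-- Initial seed: arrows 1→2, 1→5, 3→1, 4→1, 4→5, 5→2, 5→3, 2⇉3, 3⇉4.

Q0 : Quiver
Q0 zero (suc zero) = 1
Q0 zero (suc (suc (suc (suc zero)))) = 1
Q0 (suc (suc zero)) zero = 1
Q0 (suc (suc (suc zero))) zero = 1
Q0 (suc (suc (suc zero))) (suc (suc (suc (suc zero)))) = 1
Q0 (suc (suc (suc (suc zero)))) (suc zero) = 1
Q0 (suc (suc (suc (suc zero)))) (suc (suc zero)) = 1
Q0 (suc zero) (suc (suc zero)) = 2
Q0 (suc (suc zero)) (suc (suc (suc zero))) = 2
Q0 _ _ = 0

seed0 : Seed
seed0 = Q0 , varf

clusterOf : (Seed → Seed) → Cluster
clusterOf ρ = proj₂ (ρ seed0)

infix 4 _≈c_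
_≈c_ : Cluster → Cluster → Set
y ≈c z = ∀ (i : Fin 5) → y i ≈f z i

-- Every cluster in the statement is an explicit rational function in x₁,…,x₅,
-- so each claimed equality is a polynomial identity between cross products
-- num · den′ and num′ · den.  Such identities are decided by computing normal
-- forms (terms sorted lexicographically by exponent vector, like monomials
-- merged, zero coefficients dropped); normalisation preserves every
-- coefficient, so equal normal forms give equal polynomials.
module Submission where

open import Defs
open import Data.Product using (_×_; _,_)
open import Data.Nat using (ℕ; _<ᵇ_; _≡ᵇ_)
import Data.Nat as ℕ
open import Data.Integer using (ℤ; +_; _+_)
import Data.Integer as ℤ
open import Data.Integer.Properties using (+-assoc; +-identityˡ; +-commutativeSemigroup)
open import Algebra.Properties.CommutativeSemigroup +-commutativeSemigroup using (x∙yz≈y∙xz)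
open import Data.Vec using (Vec; []; _∷_; tabulate; lookup)
open import Data.Vec.Properties using (≡-dec; lookup∘tabulate)
open import Data.List using ([]; _∷_; foldr)
open import Data.Bool using (Bool; true; false; _∧_; _∨_; if_then_else_)
open import Relation.Nullary using (yes; no)
open import Relation.Nullary.Decidable using (⌊_⌋)
open import Relation.Binary.PropositionalEquality
open ≡-Reasoning

lexLess : ∀ {n} → Vec ℕ n → Vec ℕ n → Bool
lexLess []       []       = false
lexLess (a ∷ as) (b ∷ bs) = (a <ᵇ b) ∨ ((a ≡ᵇ b) ∧ lexLess as bs)

termCoeff : Term → Mono → ℤ
termCoeff (c · e) m = if ⌊ ≡-dec ℕ._≟_ e m ⌋ then c else + 0

termCoeff-+ : ∀ c d e m → termCoeff (c · e) m + termCoeff (d · e) m ≡ termCoeff ((c + d) · e) m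
termCoeff-+ c d e m with ≡-dec ℕ._≟_ e m
... | yes _ = refl
... | no  _ = refl

termCoeff-zero : ∀ e m → termCoeff ((+ 0) · e) m ≡ + 0
termCoeff-zero e m with ≡-dec ℕ._≟_ e m
... | yes _ = refl
... | no  _ = refl

coeffOf-∷ : ∀ t p m → coeffOf (t ∷ p) m ≡ termCoeff t m + coeffOf p m
coeffOf-∷ (c · e) p m = refl

consTerm : Term → Poly → Poly
consTerm (c · e) p = if ⌊ c ℤ.≟ + 0 ⌋ then p else (c · e) ∷ p

coeffOf-consTerm : ∀ t p m → coeffOf (consTerm t p) m ≡ termCoeff t m + coeffOf p m
coeffOf-consTerm (c · e) p m with c ℤ.≟ + 0
... | yes refl = sym (trans (cong (λ r → r + coeffOf p m) (termCoeff-zero e m)) (+-identityˡ _))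
... | no  _    = refl

insertTerm : Term → Poly → Poly
insertTerm t [] = t ∷ []
insertTerm (c · e) ((d · f) ∷ p) with ≡-dec ℕ._≟_ e f | lexLess e f
... | yes _ | _     = consTerm ((c + d) · f) p
... | no  _ | false = (d · f) ∷ insertTerm (c · e) p
... | no  _ | _     = (c · e) ∷ (d · f) ∷ p

coeffOf-insertTerm : ∀ t p m → coeffOf (insertTerm t p) m ≡ termCoeff t m + coeffOf p m
coeffOf-insertTerm t [] m = coeffOf-∷ t [] m
coeffOf-insertTerm (c · e) ((d · f) ∷ p) m with ≡-dec ℕ._≟_ e f | lexLess e f
... | yes refl | _ = begin
  coeffOf (consTerm ((c + d) · e) p) m                      ≡⟨ coeffOf-consTerm ((c + d) · e) p m ⟩
  termCoeff ((c + d) · e) m + coeffOf p m                   ≡⟨ cong (λ r → r + coeffOf p m) (termCoeff-+ c d e m) ⟨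
  termCoeff (c · e) m + termCoeff (d · e) m + coeffOf p m   ≡⟨ +-assoc (termCoeff (c · e) m) (termCoeff (d · e) m) (coeffOf p m) ⟩
  termCoeff (c · e) m + (termCoeff (d · e) m + coeffOf p m) ∎
... | no _ | false = begin
  termCoeff (d · f) m + coeffOf (insertTerm (c · e) p) m     ≡⟨ cong (λ r → termCoeff (d · f) m + r) (coeffOf-insertTerm (c · e) p m) ⟩
  termCoeff (d · f) m + (termCoeff (c · e) m + coeffOf p m)  ≡⟨ x∙yz≈y∙xz (termCoeff (d · f) m) (termCoeff (c · e) m) (coeffOf p m) ⟩
  termCoeff (c · e) m + (termCoeff (d · f) m + coeffOf p m)  ∎
... | no _ | true = refl

normalize : Poly → Poly
normalize = foldr insertTerm []

coeffOf-normalize : ∀ p m → coeffOf (normalize p) m ≡ coeffOf p m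
coeffOf-normalize [] m = refl
coeffOf-normalize (t ∷ p) m = begin
  coeffOf (insertTerm t (normalize p)) m   ≡⟨ coeffOf-insertTerm t (normalize p) m ⟩
  termCoeff t m + coeffOf (normalize p) m  ≡⟨ cong (λ r → termCoeff t m + r) (coeffOf-normalize p m) ⟩
  termCoeff t m + coeffOf p m              ≡⟨ coeffOf-∷ t p m ⟨
  coeffOf (t ∷ p) m                        ∎

≈ₚ-byNormalize : ∀ p q → normalize p ≡ normalize q → p ≈ₚ q
≈ₚ-byNormalize p q eq m = begin
  coeffOf p m             ≡⟨ coeffOf-normalize p m ⟨
  coeffOf (normalize p) m ≡⟨ cong (λ r → coeffOf r m) eq ⟩
  coeffOf (normalize q) m ≡⟨ coeffOf-normalize q m ⟩
  coeffOf q m             ∎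

crossNormalForms : Cluster → Cluster → Vec Poly 5
crossNormalForms y z = tabulate λ i → normalize (num (y i) *ₚ den (z i))

≈c-byNormalize : ∀ y z → crossNormalForms y z ≡ crossNormalForms z y → y ≈c z
≈c-byNormalize y z eq i = ≈ₚ-byNormalize (num (y i) *ₚ den (z i)) (num (z i) *ₚ den (y i)) (begin
  normalize (num (y i) *ₚ den (z i)) ≡⟨ lookup∘tabulate (λ j → normalize (num (y j) *ₚ den (z j))) i ⟨
  lookup (crossNormalForms y z) i    ≡⟨ cong (λ v → lookup v i) eq ⟩
  lookup (crossNormalForms z y) i    ≡⟨ lookup∘tabulate (λ j → normalize (num (z j) *ₚ den (y j))) i ⟩
  normalize (num (z i) *ₚ den (y i)) ∎)

proposition3p2 :
    (clusterOf ρ4 ≈c clusterOf (ρ1 ⨾ ρ1 ⨾ ρ3))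
    × (clusterOf ρ5 ≈c clusterOf (ρ2 ⨾ ρ2 ⨾ ρ3))
    × (clusterOf ρ6 ≈c clusterOf (ρ1 ⨾ ρ1))
    × (clusterOf ρ7 ≈c clusterOf (ρ2 ⨾ ρ2))
    × (clusterOf (ρ1 ⨾ ρ2) ≈c varf)
    × (clusterOf (ρ2 ⨾ ρ1) ≈c varf)
    × (clusterOf (ρ3 ⨾ ρ3) ≈c varf)
    × (clusterOf (ρ1 ⨾ ρ1 ⨾ ρ3) ≈c clusterOf (ρ3 ⨾ ρ1 ⨾ ρ1))
    × (clusterOf (ρ2 ⨾ ρ2 ⨾ ρ3) ≈c clusterOf (ρ3 ⨾ ρ2 ⨾ ρ2))
    × (clusterOf (ρ1 ⨾ ρ3 ⨾ ρ2) ≈c clusterOf (ρ2 ⨾ ρ3 ⨾ ρ1))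
proposition3p2 =
    ≈c-byNormalize (clusterOf ρ4) (clusterOf (ρ1 ⨾ ρ1 ⨾ ρ3)) refl
  , ≈c-byNormalize (clusterOf ρ5) (clusterOf (ρ2 ⨾ ρ2 ⨾ ρ3)) refl
  , ≈c-byNormalize (clusterOf ρ6) (clusterOf (ρ1 ⨾ ρ1)) refl
  , ≈c-byNormalize (clusterOf ρ7) (clusterOf (ρ2 ⨾ ρ2)) refl
  , ≈c-byNormalize (clusterOf (ρ1 ⨾ ρ2)) varf refl
  , ≈c-byNormalize (clusterOf (ρ2 ⨾ ρ1)) varf refl
  , ≈c-byNormalize (clusterOf (ρ3 ⨾ ρ3)) varf refl
  , ≈c-byNormalize (clusterOf (ρ1 ⨾ ρ1 ⨾ ρ3)) (clusterOf (ρ3 ⨾ ρ1 ⨾ ρ1)) refl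
  , ≈c-byNormalize (clusterOf (ρ2 ⨾ ρ2 ⨾ ρ3)) (clusterOf (ρ3 ⨾ ρ2 ⨾ ρ2)) refl
  , ≈c-byNormalize (clusterOf (ρ1 ⨾ ρ3 ⨾ ρ2)) (clusterOf (ρ2 ⨾ ρ3 ⨾ ρ1)) refl
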